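{- Let $H$ be a triangle-free graph without isolated vertices and let $G = L(H)$ be its line graph. Then $G$ is a CIS graph if and only if $H$ is randomly internally matchable.
   Context: All graphs are finite, simple and non-null. A graph is CIS if every inclusion-maximal clique intersects every inclusion-maximal stable set. The line graph $L(H)$ has vertex set $E(H)$, two distinct edges being adjacent iff they share an endpoint. An internal vertex is a vertex of degree at least two. A matching is a perfect internal matching if it saturates (covers) every internal vertex. A graph is randomly internally matchable if every maximal matching (inclusion-maximal) is a perfect internal matching, equivalently every matching extends to a perfect internal matching. -}

module Defs where

open import Data.Nat using (ℕ; _≤_; _<_)
open import Data.Fin as Fin using (Fin)
open import Data.Bool using (Bool; true; false; if_then_else_)
open import Data.List using (List; map; allFin)
open import Data.Nat.ListAction using (sum)
open import Data.Product using (Σ; ∃; _×_; _,_; proj₁; proj₂)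
open import Data.Sum using (_⊎_)
open import Relation.Binary.PropositionalEquality using (_≡_; _≢_)
open import Relation.Nullary using (¬_)

record Graph : Set₁ where
  field
    V   : Set
    Adj : V → V → Set

Subset : Set → Set
Subset A = A → Bool

_∈_ : {A : Set} → A → Subset A → Set
x ∈ S = S x ≡ true

_⊆_ : {A : Set} → Subset A → Subset A → Set
S ⊆ T = ∀ x → x ∈ S → x ∈ T

module _ (G : Graph) where
  open Graph G

  IsClique : Subset V → Set
  IsClique C = ∀ u v → u ∈ C → v ∈ C → u ≢ v → Adj u v

  IsStable : Subset V → Set
  IsStable S = ∀ u v → u ∈ S → v ∈ S → ¬ Adj u v

  IsMaximalClique : Subset V → Set
  IsMaximalClique C = IsClique C × (∀ D → IsClique D → C ⊆ D → D ⊆ C)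

  IsMaximalStable : Subset V → Set
  IsMaximalStable S = IsStable S × (∀ T → IsStable T → S ⊆ T → T ⊆ S)

  IsCIS : Set
  IsCIS = ∀ C S → IsMaximalClique C → IsMaximalStable S → ∃ λ v → v ∈ C × v ∈ S

record FinGraph : Set where
  field
    n     : ℕ
    adj   : Fin n → Fin n → Bool
    sym   : ∀ u v → adj u v ≡ adj v u
    irrefl : ∀ v → adj v v ≡ false

module _ (H : FinGraph) where
  open FinGraph H

  Adjacent : Fin n → Fin n → Set
  Adjacent u v = adj u v ≡ true

  NonNull : Set
  NonNull = 0 < n

  degree : Fin n → ℕ
  degree v = sum (map (λ u → if adj v u then 1 else 0) (allFin n))

  Internal : Fin n → Set
  Internal v = 2 ≤ degree v

  NoIsolated : Set
  NoIsolated = ∀ v → ∃ λ u → Adjacent v u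

  TriangleFree : Set
  TriangleFree = ∀ u v w → Adjacent u v → Adjacent v w → ¬ Adjacent u w

  -- an edge {u,v} is represented uniquely as (u , v) with u < v
  Edge : Set
  Edge = Σ (Fin n × Fin n) λ p → proj₁ p Fin.< proj₂ p × Adjacent (proj₁ p) (proj₂ p)

  _incident_ : Fin n → Edge → Set
  x incident ((u , v) , _) = x ≡ u ⊎ x ≡ v

  ShareEndpoint : Edge → Edge → Set
  ShareEndpoint e f = ∃ λ x → x incident e × x incident f

  LineGraph : Graph
  LineGraph = record { V = Edge ; Adj = λ e f → e ≢ f × ShareEndpoint e f }

  IsMatching : Subset Edge → Set
  IsMatching M = ∀ e f → e ∈ M → f ∈ M → e ≢ f → ¬ ShareEndpoint e f

  IsMaximalMatching : Subset Edge → Set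
  IsMaximalMatching M = IsMatching M × (∀ M' → IsMatching M' → M ⊆ M' → M' ⊆ M)

  Saturates : Subset Edge → Fin n → Set
  Saturates M x = ∃ λ e → e ∈ M × x incident e

  IsPerfectInternalMatching : Subset Edge → Set
  IsPerfectInternalMatching M = IsMatching M × (∀ x → Internal x → Saturates M x)

  RandomlyInternallyMatchable : Set
  RandomlyInternallyMatchable = ∀ M → IsMaximalMatching M → IsPerfectInternalMatching M

-- In a triangle-free graph, edges that pairwise meet all pass through one vertex, so a maximal
-- clique of L(H) containing the edge uv is the star of u or of v. The star of an internal vertex
-- is a maximal clique, and the star of a leaf is maximal only when uv is an isolated edge.
-- Maximal stable sets of L(H) are the maximal matchings of H; a matching meets the star of x
-- iff it saturates x, and an isolated edge lies in every maximal matching. Hence every maximal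
-- clique meets every maximal matching iff every maximal matching saturates all internal vertices.

module Submission where

open import Defs
open import Function.Bundles using (_⇔_; mk⇔)
open import Data.Nat using (ℕ; _≤_; _≤?_; z≤n; s≤s)
import Data.Nat.Properties as ℕ
open import Data.Fin as Fin using (Fin)
import Data.Fin.Properties as Fin
open import Data.Bool using (Bool; true; false; if_then_else_; _∨_)
import Data.Bool.Properties as Bool
open import Data.List using (List; _∷_; map; allFin)
open import Data.Nat.ListAction using (sum)
open import Data.List.Membership.Propositional using () renaming (_∈_ to _∈ˡ_)
open import Data.List.Membership.Propositional.Properties using (∈-allFin)
open import Data.List.Relation.Unary.Any using (here; there)
open import Data.List.Relation.Unary.All using (lookup)
open import Data.List.Relation.Unary.AllPairs using (_∷_)
open import Data.List.Relation.Unary.Unique.Propositional using (Unique)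
open import Data.List.Relation.Unary.Unique.Propositional.Properties using (allFin⁺)
open import Data.Product using (Σ; ∃; ∃₂; _×_; _,_; proj₁; proj₂)
open import Data.Sum using (_⊎_; inj₁; inj₂; [_,_]′)
open import Relation.Binary.PropositionalEquality
open import Relation.Binary.Definitions using (DecidableEquality; tri<; tri≈; tri>)
open import Relation.Nullary using (¬_; Dec; yes; no; does; contradiction)
open import Relation.Nullary.Decidable using (dec-true; decidable-stable; map′)
open import Axiom.UniquenessOfIdentityProofs using (module Decidable⇒UIP)

dec-true⁻¹ : ∀ {P : Set} (P? : Dec P) → does P? ≡ true → P
dec-true⁻¹ (yes p) _ = p
dec-true⁻¹ (no _) ()

∨-true⁻¹ : ∀ a {b} → (a ∨ b) ≡ true → a ≡ true ⊎ b ≡ true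
∨-true⁻¹ true  _ = inj₁ refl
∨-true⁻¹ false p = inj₂ p

module _ (G : Graph) (_≟_ : DecidableEquality (Graph.V G)) where
  open Graph G

  ｛_｝ : V → Subset V
  ｛ w ｝ v = does (v ≟ w)

  _∪｛_｝ : Subset V → V → Subset V
  (S ∪｛ w ｝) v = S v ∨ does (v ≟ w)

  ∈｛｝⁻¹ : ∀ {v w} → v ∈ ｛ w ｝ → v ≡ w
  ∈｛｝⁻¹ {v} {w} = dec-true⁻¹ (v ≟ w)

  w∈｛w｝ : ∀ w → w ∈ ｛ w ｝
  w∈｛w｝ w = dec-true (w ≟ w) refl

  singleton-isClique : ∀ w → IsClique G ｛ w ｝
  singleton-isClique w u v u∈ v∈ u≢v = contradiction (trans (∈｛｝⁻¹ u∈) (sym (∈｛｝⁻¹ v∈))) u≢v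

  maximalClique-nonempty : V → ∀ {C} → Dec (∃ (_∈ C)) → IsMaximalClique G C → ∃ (_∈ C)
  maximalClique-nonempty w (yes v∈C) _ = v∈C
  maximalClique-nonempty w (no C≡∅) (_ , maximal) =
    contradiction (w , maximal ｛ w ｝ (singleton-isClique w) (λ v v∈C → contradiction (v , v∈C) C≡∅) w (w∈｛w｝ w)) C≡∅

  isolated∈maximalStable : ∀ {w S} → (∀ v → ¬ Adj w v × ¬ Adj v w) → IsMaximalStable G S → w ∈ S
  isolated∈maximalStable {w} {S} isolated (S-stable , maximal) =
    maximal (S ∪｛ w ｝) stable (λ v v∈S → cong (_∨ _) v∈S) w
      (trans (cong (S w ∨_) (w∈｛w｝ w)) (Bool.∨-zeroʳ (S w)))
    where
    stable : IsStable G (S ∪｛ w ｝)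
    stable u v u∈ v∈ with ∨-true⁻¹ (S u) u∈ | ∨-true⁻¹ (S v) v∈
    ... | inj₁ u∈S | inj₁ v∈S = S-stable u v u∈S v∈S
    ... | inj₂ u≡w | _        rewrite dec-true⁻¹ (u ≟ w) u≡w = proj₁ (isolated v)
    ... | inj₁ _   | inj₂ v≡w rewrite dec-true⁻¹ (v ≟ w) v≡w = proj₂ (isolated u)

module _ {A : Set} (p : A → Bool) where

  count : List A → ℕ
  count xs = sum (map (λ u → if p u then 1 else 0) xs)

  count≥1 : ∀ {a xs} → a ∈ˡ xs → p a ≡ true → 1 ≤ count xs
  count≥1 {xs = x ∷ xs} (here refl) pa rewrite pa = s≤s z≤n
  count≥1 {xs = x ∷ xs} (there a∈) pa = ℕ.≤-trans (count≥1 a∈ pa) (ℕ.m≤n+m _ _)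

  count≥2 : ∀ {a b xs} → a ∈ˡ xs → b ∈ˡ xs → a ≢ b → p a ≡ true → p b ≡ true → 2 ≤ count xs
  count≥2 (here refl) (here refl) a≢b _  _  = contradiction refl a≢b
  count≥2 (here refl) (there b∈) _   pa pb rewrite pa = s≤s (count≥1 b∈ pb)
  count≥2 (there a∈) (here refl) _   pa pb rewrite pb = s≤s (count≥1 a∈ pa)
  count≥2 {xs = x ∷ xs} (there a∈) (there b∈) a≢b pa pb =
    ℕ.≤-trans (count≥2 a∈ b∈ a≢b pa pb) (ℕ.m≤n+m _ _)

  count≥1⁻¹ : ∀ xs → 1 ≤ count xs → ∃ λ a → a ∈ˡ xs × p a ≡ true
  count≥1⁻¹ (x ∷ xs) c with p x in px
  ... | true  = x , here refl , px
  ... | false with count≥1⁻¹ xs c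
  ...   | a , a∈ , pa = a , there a∈ , pa

  count≥2⁻¹ : ∀ {xs} → Unique xs → 2 ≤ count xs → ∃₂ λ a b → a ≢ b × p a ≡ true × p b ≡ true
  count≥2⁻¹ {x ∷ xs} (x∉xs ∷ unique) c with p x in px
  ... | true with count≥1⁻¹ xs (ℕ.≤-pred c)
  ...   | b , b∈ , pb = x , b , lookup x∉xs b∈ , px , pb
  count≥2⁻¹ {x ∷ xs} (_ ∷ unique) c | false = count≥2⁻¹ unique c

module _ (H : FinGraph) where
  open FinGraph H renaming (sym to adj-sym)

  private
    L : Graph
    L = LineGraph H

  _∈ᵉ_ : Fin n → Edge H → Set
  x ∈ᵉ e = _incident_ H x e

  Adjacent⇒≢ : ∀ {x y} → Adjacent H x y → x ≢ y
  Adjacent⇒≢ {x} xy refl with () ← trans (sym xy) (irrefl x)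

  Edge-≡ : ∀ {a b c d lt lt′ ab cd} → a ≡ c → b ≡ d →
           _≡_ {A = Edge H} ((a , b) , lt , ab) ((c , d) , lt′ , cd)
  Edge-≡ {lt = lt} {lt′} {ab} {cd} refl refl
    rewrite Fin.<-irrelevant lt lt′ | Decidable⇒UIP.≡-irrelevant Bool._≟_ ab cd = refl

  _≟ᵉ_ : DecidableEquality (Edge H)
  ((a , b) , _) ≟ᵉ ((c , d) , _) with a Fin.≟ c | b Fin.≟ d
  ... | yes a≡c | yes b≡d = yes (Edge-≡ a≡c b≡d)
  ... | no  a≢c | _       = no λ e≡f → a≢c (cong (λ e → proj₁ (proj₁ e)) e≡f)
  ... | yes _   | no b≢d  = no λ e≡f → b≢d (cong (λ e → proj₂ (proj₁ e)) e≡f)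

  _∈ᵉ?_ : ∀ x e → Dec (x ∈ᵉ e)
  x ∈ᵉ? ((a , b) , _) with x Fin.≟ a | x Fin.≟ b
  ... | yes x≡a | _       = yes (inj₁ x≡a)
  ... | no  _   | yes x≡b = yes (inj₂ x≡b)
  ... | no  x≢a | no  x≢b = no λ { (inj₁ x≡a) → x≢a x≡a ; (inj₂ x≡b) → x≢b x≡b }

  endpoints-adjacent : ∀ {x y} e → x ∈ᵉ e → y ∈ᵉ e → x ≢ y → Adjacent H x y
  endpoints-adjacent _ (inj₁ refl) (inj₁ refl) x≢y = contradiction refl x≢y
  endpoints-adjacent (_ , _ , ab) (inj₁ refl) (inj₂ refl) _ = ab
  endpoints-adjacent ((a , b) , _ , ab) (inj₂ refl) (inj₁ refl) _ = trans (adj-sym b a) ab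
  endpoints-adjacent _ (inj₂ refl) (inj₂ refl) x≢y = contradiction refl x≢y

  ∈ᵉ-endpoints : ∀ {x y z} e → x ∈ᵉ e → y ∈ᵉ e → x ≢ y → z ∈ᵉ e → z ≡ x ⊎ z ≡ y
  ∈ᵉ-endpoints _ (inj₁ refl) (inj₁ refl) x≢y _ = contradiction refl x≢y
  ∈ᵉ-endpoints _ (inj₁ refl) (inj₂ refl) _   z∈ = z∈
  ∈ᵉ-endpoints _ (inj₂ refl) (inj₁ refl) _   (inj₁ z≡a) = inj₂ z≡a
  ∈ᵉ-endpoints _ (inj₂ refl) (inj₁ refl) _   (inj₂ z≡b) = inj₁ z≡b
  ∈ᵉ-endpoints _ (inj₂ refl) (inj₂ refl) x≢y _ = contradiction refl x≢y

  other-endpoint : ∀ {x} e → x ∈ᵉ e → ∃ λ y → y ∈ᵉ e × y ≢ x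
  other-endpoint ((a , b) , a<b , _) (inj₁ refl) = b , inj₂ refl , λ b≡a → Fin.<-irrefl (sym b≡a) a<b
  other-endpoint ((a , b) , a<b , _) (inj₂ refl) = a , inj₁ refl , λ a≡b → Fin.<-irrefl a≡b a<b

  Edge-ext : ∀ {e f} → (∀ x → x ∈ᵉ e → x ∈ᵉ f) → e ≡ f
  Edge-ext {(a , b) , a<b , _} {(c , d) , c<d , _} e⊆f with e⊆f a (inj₁ refl) | e⊆f b (inj₂ refl)
  ... | inj₁ a≡c  | inj₂ b≡d  = Edge-≡ a≡c b≡d
  ... | inj₁ refl | inj₁ refl = contradiction a<b (Fin.<-irrefl refl)
  ... | inj₂ refl | inj₂ refl = contradiction a<b (Fin.<-irrefl refl)
  ... | inj₂ refl | inj₁ refl = contradiction c<d (Fin.<-asym a<b)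

  edge-between : ∀ {a b} → Adjacent H a b → ∃ λ e → a ∈ᵉ e × b ∈ᵉ e
  edge-between {a} {b} ab with Fin.<-cmp a b
  ... | tri< a<b _ _ = ((a , b) , a<b , ab) , inj₁ refl , inj₂ refl
  ... | tri> _ _ b<a = ((b , a) , b<a , trans (adj-sym b a) ab) , inj₂ refl , inj₁ refl
  ... | tri≈ _ a≡b _ = contradiction a≡b (Adjacent⇒≢ ab)

  internal? : ∀ x → Dec (Internal H x)
  internal? x = 2 ≤? degree H x

  internal⁺ : ∀ {x a b} → a ≢ b → Adjacent H x a → Adjacent H x b → Internal H x
  internal⁺ {x} a≢b xa xb = count≥2 (adj x) (∈-allFin _) (∈-allFin _) a≢b xa xb

  internal⁻ : ∀ {x} → Internal H x → ∃₂ λ a b → a ≢ b × Adjacent H x a × Adjacent H x b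
  internal⁻ {x} = count≥2⁻¹ (adj x) (allFin⁺ n)

  non-internal⇒unique-edge : ∀ {x} e f → ¬ Internal H x → x ∈ᵉ e → x ∈ᵉ f → e ≡ f
  non-internal⇒unique-edge {x} e f ¬internal x∈e x∈f
    with other-endpoint e x∈e | other-endpoint f x∈f
  ... | y , y∈e , y≢x | z , z∈f , z≢x with y Fin.≟ z
  ...   | no y≢z = contradiction (internal⁺ y≢z (endpoints-adjacent e x∈e y∈e (≢-sym y≢x))
                                                 (endpoints-adjacent f x∈f z∈f (≢-sym z≢x))) ¬internal
  ...   | yes refl = Edge-ext λ w w∈e → [ (λ { refl → x∈f }) , (λ { refl → z∈f }) ]′
                                         (∈ᵉ-endpoints e x∈e y∈e (≢-sym y≢x) w∈e)

  some-edge : NonNull H → NoIsolated H → Edge H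
  some-edge 0<n no-isolated = proj₁ (edge-between (proj₂ (no-isolated (Fin.fromℕ< 0<n))))

  EdgeIn : Subset (Edge H) → Fin n → Fin n → Set
  EdgeIn C i j = Σ (i Fin.< j) λ i<j → Σ (Adjacent H i j) λ ij → ((i , j) , i<j , ij) ∈ C

  edgeIn? : ∀ C i j → Dec (EdgeIn C i j)
  edgeIn? C i j with i Fin.<? j
  ... | no i≮j = no λ (i<j , _) → i≮j i<j
  ... | yes i<j with adj i j Bool.≟ true
  ...   | no ¬ij = no λ (_ , ij , _) → ¬ij ij
  ...   | yes ij with C ((i , j) , i<j , ij) Bool.≟ true
  ...     | yes e∈C = yes (i<j , ij , e∈C)
  ...     | no  e∉C = no λ (_ , _ , e′∈C) → e∉C (subst (_∈ C) (Edge-≡ refl refl) e′∈C)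

  edge∈? : (C : Subset (Edge H)) → Dec (∃ (_∈ C))
  edge∈? C = map′ (λ (i , j , i<j , ij , e∈C) → ((i , j) , i<j , ij) , e∈C)
                  (λ (((i , j) , i<j , ij) , e∈C) → i , j , i<j , ij , e∈C)
                  (Fin.any? λ i → Fin.any? λ j → edgeIn? C i j)

  star : Fin n → Subset (Edge H)
  star x e = does (x ∈ᵉ? e)

  ∈star⁺ : ∀ {x} e → x ∈ᵉ e → e ∈ star x
  ∈star⁺ {x} e = dec-true (x ∈ᵉ? e)

  ∈star⁻ : ∀ {x} e → e ∈ star x → x ∈ᵉ e
  ∈star⁻ {x} e = dec-true⁻¹ (x ∈ᵉ? e)

  star-isClique : ∀ x → IsClique L (star x)
  star-isClique x e f e∈ f∈ e≢f = e≢f , x , ∈star⁻ e e∈ , ∈star⁻ f f∈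

  clique-meets-edge : ∀ {C u v} → IsClique L C → ∀ e f → e ∈ C → f ∈ C →
                      u ∈ᵉ e → v ∈ᵉ e → u ≢ v → u ∈ᵉ f ⊎ v ∈ᵉ f
  clique-meets-edge C-clique e f e∈C f∈C u∈e v∈e u≢v with f ≟ᵉ e
  ... | yes refl = inj₁ u∈e
  ... | no f≢e with C-clique f e f∈C e∈C f≢e
  ...   | _ , y , y∈f , y∈e with ∈ᵉ-endpoints e u∈e v∈e u≢v y∈e
  ...     | inj₁ refl = inj₁ y∈f
  ...     | inj₂ refl = inj₂ y∈f

  non-internal-edge-isolated : ∀ e → (∀ y → y ∈ᵉ e → ¬ Internal H y) →
                               ∀ f → ¬ Graph.Adj L e f × ¬ Graph.Adj L f e
  non-internal-edge-isolated e non-internal f =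
      (λ (e≢f , y , y∈e , y∈f) → e≢f (non-internal⇒unique-edge e f (non-internal y y∈e) y∈e y∈f))
    , (λ (f≢e , y , y∈f , y∈e) → f≢e (non-internal⇒unique-edge f e (non-internal y y∈e) y∈f y∈e))

  matching⇒stable : ∀ {M} → IsMatching H M → IsStable L M
  matching⇒stable matching e f e∈ f∈ (e≢f , shared) = matching e f e∈ f∈ e≢f shared

  stable⇒matching : ∀ {M} → IsStable L M → IsMatching H M
  stable⇒matching stable e f e∈ f∈ e≢f shared = stable e f e∈ f∈ (e≢f , shared)

  maximalMatching⇒maximalStable : ∀ {M} → IsMaximalMatching H M → IsMaximalStable L M
  maximalMatching⇒maximalStable (matching , maximal) =
    matching⇒stable matching , λ T T-stable → maximal T (stable⇒matching T-stable)

  maximalStable⇒maximalMatching : ∀ {M} → IsMaximalStable L M → IsMaximalMatching H M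
  maximalStable⇒maximalMatching (stable , maximal) =
    stable⇒matching stable , λ T T-matching → maximal T (matching⇒stable T-matching)

  module _ (triangle-free : TriangleFree H) where

    clique-⊆-star : ∀ {C u v} → IsClique L C → ∀ e h → e ∈ C → h ∈ C →
                    u ∈ᵉ e → v ∈ᵉ e → u ≢ v → ¬ u ∈ᵉ h → C ⊆ star v
    clique-⊆-star {C} {u} {v} C-clique e h e∈C h∈C u∈e v∈e u≢v u∉h f f∈C =
      ∈star⁺ f (decidable-stable (v ∈ᵉ? f) ¬v∉f)
      where
      v∈h : v ∈ᵉ h
      v∈h = [ (λ u∈h → contradiction u∈h u∉h) , (λ v∈h → v∈h) ]′
              (clique-meets-edge C-clique e h e∈C h∈C u∈e v∈e u≢v)

      ¬v∉f : ¬ ¬ v ∈ᵉ f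
      ¬v∉f v∉f with clique-meets-edge C-clique e f e∈C f∈C u∈e v∈e u≢v
      ... | inj₂ v∈f = v∉f v∈f
      ... | inj₁ u∈f with C-clique h f h∈C f∈C (λ { refl → u∉h u∈f })
      ...   | _ , y , y∈h , y∈f =
        triangle-free u v y (endpoints-adjacent e u∈e v∈e u≢v)
                            (endpoints-adjacent h v∈h y∈h λ { refl → v∉f y∈f })
                            (endpoints-adjacent f u∈f y∈f λ { refl → u∉h y∈h })

    star⊆clique⇒neighbour∈ᵉ : ∀ {D x a} → IsClique L D → star x ⊆ D → Adjacent H x a →
                    ∀ g → g ∈ D → ¬ x ∈ᵉ g → a ∈ᵉ g
    star⊆clique⇒neighbour∈ᵉ {D} {x} D-clique star⊆D xa g g∈D x∉g =
      let e , x∈e , a∈e = edge-between xa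
      in ∈star⁻ g (clique-⊆-star D-clique e g (star⊆D e (∈star⁺ e x∈e)) g∈D
                                 x∈e a∈e (Adjacent⇒≢ xa) x∉g g g∈D)

    star-isMaximalClique : ∀ {x} → Internal H x → IsMaximalClique L (star x)
    star-isMaximalClique {x} x-internal = star-isClique x , maximal
      where
      maximal : ∀ D → IsClique L D → star x ⊆ D → D ⊆ star x
      maximal D D-clique star⊆D g g∈D = ∈star⁺ g (decidable-stable (x ∈ᵉ? g) λ x∉g →
        let a , b , a≢b , xa , xb = internal⁻ x-internal
            a∈g = star⊆clique⇒neighbour∈ᵉ D-clique star⊆D xa g g∈D x∉g
            b∈g = star⊆clique⇒neighbour∈ᵉ D-clique star⊆D xb g g∈D x∉g
        in triangle-free x a b xa (endpoints-adjacent g a∈g b∈g a≢b) xb)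

    cis⇒randomlyInternallyMatchable : IsCIS L → RandomlyInternallyMatchable H
    cis⇒randomlyInternallyMatchable cis M M-maximal = proj₁ M-maximal , λ x x-internal →
      let e , e∈star , e∈M = cis (star x) M (star-isMaximalClique x-internal)
                                 (maximalMatching⇒maximalStable M-maximal)
      in e , e∈M , ∈star⁻ e e∈star

    maximalClique-⊆-star : ∀ {C u v} → IsMaximalClique L C → ∀ e g → e ∈ C →
                           u ∈ᵉ e → v ∈ᵉ e → u ≢ v → u ∈ᵉ g → ¬ g ∈ C → C ⊆ star v
    maximalClique-⊆-star {u = u} {v} (C-clique , maximal) e g e∈C u∈e v∈e u≢v u∈g g∉C h h∈C =
      ∈star⁺ h (decidable-stable (v ∈ᵉ? h) λ v∉h →
        g∉C (maximal (star u) (star-isClique u)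
                     (clique-⊆-star C-clique e h e∈C h∈C v∈e u∈e (≢-sym u≢v) v∉h) g (∈star⁺ g u∈g)))

    maximalClique-meets-at-internal : ∀ {C S u v} → IsMaximalClique L C →
      (∀ x → Internal H x → Saturates H S x) →
      ∀ e → e ∈ C → u ∈ᵉ e → v ∈ᵉ e → u ≢ v → Internal H u → ∃ λ h → h ∈ C × h ∈ S
    maximalClique-meets-at-internal {C} {S} {u} {v} C-maximal saturated e e∈C u∈e v∈e u≢v u-internal
      with saturated u u-internal
    ... | g , g∈S , u∈g with C g Bool.≟ true
    ...   | yes g∈C = g , g∈C , g∈S
    ...   | no  g∉C = meets (internal? v)
      where
      star⊆C : ∀ x → C ⊆ star x → star x ⊆ C
      star⊆C x = proj₂ C-maximal (star x) (star-isClique x)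

      C⊆★v : C ⊆ star v
      C⊆★v = maximalClique-⊆-star C-maximal e g e∈C u∈e v∈e u≢v u∈g g∉C

      meets : Dec (Internal H v) → ∃ λ h → h ∈ C × h ∈ S
      meets (yes v-internal) =
        let g′ , g′∈S , v∈g′ = saturated v v-internal
        in g′ , star⊆C v C⊆★v g′ (∈star⁺ g′ v∈g′) , g′∈S
      meets (no ¬v-internal) = contradiction (star⊆C u C⊆★u g (∈star⁺ g u∈g)) g∉C
        where
        C⊆★u : C ⊆ star u
        C⊆★u h h∈C = ∈star⁺ h (subst (u ∈ᵉ_) (non-internal⇒unique-edge e h ¬v-internal v∈e
                                                  (∈star⁻ h (C⊆★v h h∈C))) u∈e)

    maximalClique-meets-perfectInternalMatching : ∀ {C S} → IsMaximalClique L C → IsMaximalStable L S →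
      (∀ x → Internal H x → Saturates H S x) → ∀ e → e ∈ C → ∃ λ h → h ∈ C × h ∈ S
    maximalClique-meets-perfectInternalMatching C-maximal S-maximal saturated e@((u , v) , _ , uv) e∈C
      with internal? u | internal? v
    ... | yes u-internal | _ =
      maximalClique-meets-at-internal C-maximal saturated e e∈C (inj₁ refl) (inj₂ refl) (Adjacent⇒≢ uv) u-internal
    ... | no _ | yes v-internal =
      maximalClique-meets-at-internal C-maximal saturated e e∈C (inj₂ refl) (inj₁ refl)
        (≢-sym (Adjacent⇒≢ uv)) v-internal
    ... | no ¬u-internal | no ¬v-internal =
      e , e∈C , isolated∈maximalStable L _≟ᵉ_ (non-internal-edge-isolated e non-internal) S-maximal
      where
      non-internal : ∀ y → y ∈ᵉ e → ¬ Internal H y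
      non-internal y (inj₁ refl) = ¬u-internal
      non-internal y (inj₂ refl) = ¬v-internal

    randomlyInternallyMatchable⇒cis : NonNull H → NoIsolated H → RandomlyInternallyMatchable H → IsCIS L
    randomlyInternallyMatchable⇒cis 0<n no-isolated rim C S C-maximal S-maximal =
      let e , e∈C = maximalClique-nonempty L _≟ᵉ_ (some-edge 0<n no-isolated) (edge∈? C) C-maximal
      in maximalClique-meets-perfectInternalMatching C-maximal S-maximal
           (proj₂ (rim S (maximalStable⇒maximalMatching S-maximal))) e e∈C

corollary5 : (H : FinGraph) → NonNull H → TriangleFree H → NoIsolated H →
    (IsCIS (LineGraph H) ⇔ RandomlyInternallyMatchable H)
corollary5 H 0<n triangle-free no-isolated =
  mk⇔ (cis⇒randomlyInternallyMatchable H triangle-free)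
      (randomlyInternallyMatchable⇒cis H triangle-free 0<n no-isolated)
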